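{- Let $\lambda\vdash n$, let $T$ be a filling of $\lambda$ by $1,\ldots,n$ with each number used once, and let $M\in\operatorname{SSYT}(\lambda)$ with $d=\Sigma(M)$. Then: - $F_{M,T}$ lies in $\mathbb{Z}[x_1,\ldots,x_n]_d$; - $F_{M,T}$ equals $\sum_{\sigma\in C(T)}\operatorname{sgn}(\sigma)\sigma p_{M,T}$ plus a linear combination of monomials $y$ satisfying $p_{M,T}>_Ty$; - every $\sigma\in\tilde C(T)$ acts on $F_{M,T}$ as multiplication by $\widetilde{\operatorname{sgn}}(\sigma)$.
   Context: $S_n$ acts on polynomials by $\sigma\cdot x_i=x_{\sigma(i)}$. $\operatorname{SSYT}(\lambda)$ consists of the semistandard fillings of $\lambda$ by non-negative integers, and $\Sigma(M)$ is the entry sum. $R(T)$ and $C(T)$ are the subgroups of $S_n$ preserving each row's, respectively each column's, set of entries of $T$. $\varepsilon_T=\sum_{\sigma\in C(T)}\sum_{\tau\in R(T)}\operatorname{sgn}(\sigma)\sigma\tau$. $p_{M,T}=\prod x_i^{h_i}$, where $h_i$ is the entry of $M$ in the box containing $i$ in $T$. $s_{M,T}$ is the number of $\tau\in R(T)$ fixing $p_{M,T}$, and $F_{M,T}=\varepsilon_Tp_{M,T}/s_{M,T}$. $\tilde C(T)$ is the subgroup of $S_n$ generated by $C(T)$ and by those elements of $R(T)$ that map the set of entries of each column of $T$ onto the set of entries of some column of $T$. It is a semidirect product in which $R(T)\cap\tilde C(T)$ acts on $C(T)$. $\widetilde{\operatorname{sgn}}:\tilde C(T)\to\{\pm1\}$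 is the character that restricts to $\operatorname{sgn}$ on $C(T)$ and is trivial on $R(T)\cap\tilde C(T)$. For a monomial $y$, $\deg_Ty$ is the vector of length $\lambda_1$ whose $j$-th entry is the sum of the exponents in $y$ of the variables $x_i$ with $i$ in column $j$ of $T$. $y>_Tz$ means that $\deg_Ty$ is strictly larger than $\deg_Tz$ in the reverse lexicographic order. -}

module Defs where

open import Data.Nat as ℕ using (ℕ; zero; suc; _≤_; _<_; _>_)
open import Data.Nat.Properties using () renaming (_≟_ to _≟ℕ_)
open import Data.Integer as ℤ using (ℤ; 0ℤ; 1ℤ; -_)
open import Data.Rational as ℚ using (ℚ; 0ℚ)
open import Data.Fin as Fin using (Fin; toℕ)
open import Data.Fin.Properties using (all?) renaming (_≟_ to _≟F_)
open import Data.List as List using (List; []; _∷_; filter; map; foldr; concatMap; allFin; length; lookup; reverse; upTo)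
open import Data.List.Relation.Unary.All using (All)
open import Data.Nat.ListAction using () renaming (sum to sumℕ)
open import Data.List.Relation.Unary.Linked using (Linked)
open import Data.Vec.Functional using () renaming (_∷_ to _◂_)
open import Data.Product using (Σ; ∃; _×_; _,_; proj₁; proj₂)
open import Data.Sum using (_⊎_)
open import Data.Empty using (⊥)
open import Function using (_∘_; _↔_; Inverse)
open import Relation.Nullary using (Dec; yes; no; ¬_)
open import Relation.Nullary.Decidable using (_→-dec_)
open import Relation.Binary.PropositionalEquality using (_≡_)

IsPartition : ℕ → List ℕ → Set
IsPartition n sh = Linked ℕ._≥_ sh × All (λ k → 0 < k) sh × sumℕ sh ≡ n

Box : List ℕ → Set
Box sh = Σ (Fin (length sh)) (λ r → Fin (lookup sh r))

rowOfBox : ∀ {sh} → Box sh → ℕ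
rowOfBox (r , _) = toℕ r

colOfBox : ∀ {sh} → Box sh → ℕ
colOfBox (_ , c) = toℕ c

IsSSYT : (sh : List ℕ) → (Box sh → ℕ) → Set
IsSSYT sh M =
  (∀ (r : Fin (length sh)) (c c' : Fin (lookup sh r)) →
     toℕ c ≤ toℕ c' → M (r , c) ≤ M (r , c'))
  × (∀ (r r' : Fin (length sh)) (c : Fin (lookup sh r)) (c' : Fin (lookup sh r')) →
     toℕ r < toℕ r' → toℕ c ≡ toℕ c' → M (r , c) < M (r' , c'))

entrySum : (sh : List ℕ) → (Box sh → ℕ) → ℕ
entrySum sh M =
  sumℕ (concatMap (λ r → map (λ c → M (r , c)) (allFin (lookup sh r))) (allFin (length sh)))

sumℤ : List ℤ → ℤ
sumℤ = foldr ℤ._+_ 0ℤ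

count : ∀ {A : Set} → (A → ℤ) → List A → ℤ
count f xs = sumℤ (map f xs)

allFuns : ∀ {n} (k : ℕ) → List (Fin k → Fin n)
allFuns zero = (λ ()) ∷ []
allFuns {n} (suc k) = concatMap (λ f → map (λ a → a ◂ f) (allFin n)) (allFuns k)

IsPerm : ∀ {n} → (Fin n → Fin n) → Set
IsPerm {n} σ = ∀ i j → σ i ≡ σ j → i ≡ j

isPerm? : ∀ {n} (σ : Fin n → Fin n) → Dec (IsPerm σ)
isPerm? σ = all? (λ i → all? (λ j → (σ i ≟F σ j) →-dec (i ≟F j)))

allPerms : (n : ℕ) → List (Fin n → Fin n)
allPerms n = filter isPerm? (allFuns n)

negOnePow : ℕ → ℤ
negOnePow zero = 1ℤ
negOnePow (suc k) = - negOnePow k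

indℤ : ∀ {P : Set} → Dec P → ℤ
indℤ (yes _) = 1ℤ
indℤ (no _) = 0ℤ

inversions : ∀ {n} → (Fin n → Fin n) → ℤ
inversions {n} σ =
  count (λ i → count (λ j → indℤ (i Fin.<? j) ℤ.* indℤ (σ j Fin.<? σ i)) (allFin n)) (allFin n)

sgn : ∀ {n} → (Fin n → Fin n) → ℤ
sgn σ = negOnePow ℤ.∣ inversions σ ∣

-- a monomial ∏ x_i^{y i} is its exponent function y
Mono : ℕ → Set
Mono n = Fin n → ℕ

_≐?_ : ∀ {n} (y z : Mono n) → Dec (∀ i → y i ≡ z i)
y ≐? z = all? (λ i → y i ≟ℕ z i)

totalDeg : ∀ {n} → Mono n → ℕ
totalDeg {n} y = sumℕ (map y (allFin n))

-- σ·x_i = x_{σ(i)}, so the coefficient of y in σ·P is the coefficient of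
-- the monomial y ∘ σ in P; in particular σ·m = y  iff  m = y ∘ σ.

LexGT : List ℕ → List ℕ → Set
LexGT [] [] = ⊥
LexGT [] (_ ∷ _) = ⊥
LexGT (_ ∷ _) [] = ⊥
LexGT (a ∷ as) (b ∷ bs) = a > b ⊎ (a ≡ b × LexGT as bs)

RevLexGT : List ℕ → List ℕ → Set
RevLexGT as bs = LexGT (reverse as) (reverse bs)

-- Everything attached to a tableau T (bijection boxes ↔ {1..n}, written Fin n)

module Tableau {n : ℕ} (sh : List ℕ) (T : Box sh ↔ Fin n) where

  open Inverse T using (to; from)

  rowOf colOf : Fin n → ℕ
  rowOf i = rowOfBox {sh} (from i)
  colOf i = colOfBox {sh} (from i)

  InR InC : (Fin n → Fin n) → Set
  InR σ = IsPerm σ × (∀ i → rowOf (σ i) ≡ rowOf i)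
  InC σ = IsPerm σ × (∀ i → colOf (σ i) ≡ colOf i)

  inR? : ∀ σ → Dec (InR σ)
  inR? σ with isPerm? σ | all? (λ i → rowOf (σ i) ≟ℕ rowOf i)
  ... | yes p | yes q = yes (p , q)
  ... | no ¬p | _ = no (λ z → ¬p (proj₁ z))
  ... | yes _ | no ¬q = no (λ z → ¬q (proj₂ z))

  inC? : ∀ σ → Dec (InC σ)
  inC? σ with isPerm? σ | all? (λ i → colOf (σ i) ≟ℕ colOf i)
  ... | yes p | yes q = yes (p , q)
  ... | no ¬p | _ = no (λ z → ¬p (proj₁ z))
  ... | yes _ | no ¬q = no (λ z → ¬q (proj₂ z))

  RList CList : List (Fin n → Fin n)
  RList = filter inR? (allPerms n)
  CList = filter inC? (allPerms n)

  module _ (M : Box sh → ℕ) where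

    p : Mono n
    p i = M (from i)

    s : ℕ
    s = ℤ.∣ count (λ τ → indℤ (p ≐? (λ i → p (τ i)))) RList ∣

    εp : Mono n → ℤ
    εp y = count (λ σ → count (λ τ → sgn σ ℤ.* indℤ (p ≐? (λ i → y (σ (τ i))))) RList) CList

    divℚ : ℤ → ℕ → ℚ
    divℚ z zero = 0ℚ            -- never used: s ≥ 1 (identity ∈ R(T))
    divℚ z (suc k) = z ℚ./ suc k

    F : Mono n → ℚ
    F y = divℚ (εp y) s

    leading : Mono n → ℤ
    leading y = count (λ σ → sgn σ ℤ.* indℤ (p ≐? (λ i → y (σ i)))) CList

  degT : Mono n → List ℕ
  degT y = map (λ j → sumℕ (map (λ i → colDeg i j) (allFin n))) (upTo λ₁')
    where
    λ₁' : ℕ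
    λ₁' = List.foldr (λ a _ → a) 0 sh
    colDeg : Fin n → ℕ → ℕ
    colDeg i j with colOf i ≟ℕ j
    ... | yes _ = y i
    ... | no _ = 0

  _>T_ : Mono n → Mono n → Set
  y >T z = RevLexGT (degT y) (degT z)

  ColPermuting : (Fin n → Fin n) → Set
  ColPermuting σ = ∀ i → ∃ λ i' →
      (∀ k → colOf k ≡ colOf i → colOf (σ k) ≡ colOf i')
    × (∀ k' → colOf k' ≡ colOf i' → ∃ λ k → colOf k ≡ colOf i × σ k ≡ k')

  -- C̃(T): generated by C(T) and the above elements of R(T)
  -- (closure under composition; in a finite group this is the generated subgroup).
  -- A derivation also records a word in the generators, on which the character
  -- s̃gn is evaluated: sgn on C(T), trivial on R(T) ∩ C̃(T).
  data InCt : (Fin n → Fin n) → Set where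
    genC : ∀ {σ} → InC σ → InCt σ
    genR : ∀ {σ} → InR σ → ColPermuting σ → InCt σ
    comp : ∀ {g h} → InCt g → InCt h → InCt (g ∘ h)

  sgnTilde : ∀ {g} → InCt g → ℤ
  sgnTilde (genC {σ} _) = sgn σ
  sgnTilde (genR _ _) = 1ℤ
  sgnTilde (comp d e) = sgnTilde d ℤ.* sgnTilde e

{-# OPTIONS --safe #-}
module Submission where

-- Write ε_T p = Σ_{σ ∈ C(T)} sgn σ · σ (Σ_{τ ∈ R(T)} τ p). The coefficient of a monomial w in the
-- inner sum is the number of τ ∈ R(T) with w ∘ τ = p; it vanishes unless w lies in the R(T)-orbit
-- of p, where it equals s_{M,T}. So every coefficient of ε_T p is s_{M,T} times an integer, and it
-- vanishes outside degree Σ(M) because permutations preserve degree. Since M is semistandard, a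
-- monomial of the row orbit of p other than p is strictly smaller than p for >_T (compare the
-- rightmost column where they differ), and C(T) does not change deg_T; so if p >_T y fails, only
-- σ p = y contributes. Finally, left translation by σ ∈ C(T) multiplies the sum over C(T) by sgn σ,
-- while conjugation by a column-permuting τ ∈ R(T) preserves C(T), sgn and the row counts.

open import Defs
open import Data.Nat as ℕ using (ℕ; zero; suc)
import Data.Nat.Properties as ℕ
open import Data.Nat.ListAction using () renaming (sum to sumℕ)
open import Data.Integer as ℤ using (ℤ; 0ℤ; 1ℤ; +_; -[1+_]; _+_; _*_; _-_; -_; _≤_; _<_)
import Data.Integer.Properties as ℤ
open import Data.Integer.Solver using (module +-*-Solver)
open import Data.Rational as ℚ using (0ℚ; _/_)
import Data.Rational.Properties as ℚ
open import Data.Rational.Unnormalised using (mkℚᵘ; *≡*)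
import Data.Rational.Unnormalised.Properties as ℚᵘ
open import Data.Fin as Fin using (Fin)
import Data.Fin.Properties as Fin
open import Data.Fin.Properties using () renaming (_≟_ to _≟F_)
open import Data.List as List using (List; []; _∷_; map; filter; concatMap; _++_; allFin; upTo; reverse)
import Data.List.Properties as List
open import Data.List.Relation.Unary.Linked using (Linked; _∷_)
open import Data.Vec.Functional using () renaming (_∷_ to _◂_)
import Data.Vec.Functional.Relation.Binary.Pointwise.Properties as Pointwise
open import Data.Product using (∃; _×_; _,_; proj₁; proj₂; map₁; map₂)
import Data.Product.Properties as Product
open import Data.Sum using (_⊎_; inj₁; inj₂)
open import Data.Empty using (⊥-elim)
open import Function using (_∘_; id; _↔_; Inverse)
open import Level using (0ℓ)
open import Relation.Nullary using (Dec; yes; no; ¬_; ¬?)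
open import Relation.Nullary.Decidable using (_×-dec_)
open import Relation.Binary using (DecSetoid; Decidable; _Preserves_⟶_; tri<; tri≈; tri>)
open import Relation.Binary.PropositionalEquality
open import Relation.Binary.PropositionalEquality.Properties using (decSetoid)

open +-*-Solver

private
  variable
    A B : Set
    P Q : Set

count-++ : ∀ (f : A → ℤ) xs ys → count f (xs ++ ys) ≡ count f xs + count f ys
count-++ f []       ys = sym (ℤ.+-identityˡ _)
count-++ f (x ∷ xs) ys = trans (cong (_+_ (f x)) (count-++ f xs ys)) (sym (ℤ.+-assoc (f x) _ _))

count-cong : ∀ {f g : A → ℤ} → (∀ x → f x ≡ g x) → ∀ xs → count f xs ≡ count g xs
count-cong f≗g []       = refl
count-cong f≗g (x ∷ xs) = cong₂ _+_ (f≗g x) (count-cong f≗g xs)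

count-map : ∀ (f : B → ℤ) (g : A → B) xs → count f (map g xs) ≡ count (f ∘ g) xs
count-map f g []       = refl
count-map f g (x ∷ xs) = cong (_+_ (f (g x))) (count-map f g xs)

count-concatMap : ∀ (f : B → ℤ) (g : A → List B) xs →
                  count f (concatMap g xs) ≡ count (count f ∘ g) xs
count-concatMap f g []       = refl
count-concatMap f g (x ∷ xs) =
  trans (count-++ f (g x) (concatMap g xs)) (cong (_+_ (count f (g x))) (count-concatMap f g xs))

count-filter : ∀ {P : A → Set} (P? : ∀ x → Dec (P x)) (f : A → ℤ) xs →
               count f (filter P? xs) ≡ count (λ x → indℤ (P? x) * f x) xs
count-filter P? f [] = refl
count-filter P? f (x ∷ xs) with P? x
... | yes _ = cong₂ _+_ (sym (ℤ.*-identityˡ (f x))) (count-filter P? f xs)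
... | no  _ = begin
  count f (filter P? xs)          ≡⟨ count-filter P? f xs ⟩
  rest                            ≡˘⟨ ℤ.+-identityˡ rest ⟩
  0ℤ + rest                       ≡˘⟨ cong (_+ rest) (ℤ.*-zeroˡ (f x)) ⟩
  0ℤ * f x + rest                 ∎
  where
  open ≡-Reasoning
  rest : ℤ
  rest = count (λ x → indℤ (P? x) * f x) xs

count-+ : ∀ (f g : A → ℤ) xs → count (λ x → f x + g x) xs ≡ count f xs + count g xs
count-+ f g []       = refl
count-+ f g (x ∷ xs) = trans (cong (_+_ (f x + g x)) (count-+ f g xs))
  (solve 4 (λ a b c d → (a :+ b) :+ (c :+ d) := (a :+ c) :+ (b :+ d)) refl (f x) (g x) (count f xs) (count g xs))

count-*ˡ : ∀ a (f : A → ℤ) xs → count (λ x → a * f x) xs ≡ a * count f xs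
count-*ˡ a f []       = sym (ℤ.*-zeroʳ a)
count-*ˡ a f (x ∷ xs) = trans (cong (_+_ (a * f x)) (count-*ˡ a f xs)) (sym (ℤ.*-distribˡ-+ a (f x) _))

count-*ʳ : ∀ a (f : A → ℤ) xs → count (λ x → f x * a) xs ≡ count f xs * a
count-*ʳ a f xs = trans (count-cong (λ x → ℤ.*-comm (f x) a) xs) (trans (count-*ˡ a f xs) (ℤ.*-comm a _))

count-zero : ∀ {f : A → ℤ} → (∀ x → f x ≡ 0ℤ) → ∀ xs → count f xs ≡ 0ℤ
count-zero f≗0 []       = refl
count-zero f≗0 (x ∷ xs) = cong₂ _+_ (f≗0 x) (count-zero f≗0 xs)

count-mono-≤ : ∀ {f g : A → ℤ} → (∀ x → f x ≤ g x) → ∀ xs → count f xs ≤ count g xs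
count-mono-≤ f≤g []       = ℤ.≤-refl
count-mono-≤ f≤g (x ∷ xs) = ℤ.+-mono-≤ (f≤g x) (count-mono-≤ f≤g xs)

count-swap : ∀ (h : A → B → ℤ) xs (ys : List B) →
             count (λ x → count (h x) ys) xs ≡ count (λ y → count (λ x → h x y) xs) ys
count-swap h []       ys = sym (count-zero (λ _ → refl) ys)
count-swap h (x ∷ xs) ys = trans (cong (_+_ (count (h x) ys)) (count-swap h xs ys))
                                 (sym (count-+ (h x) (λ y → count (λ x → h x y) xs) ys))

count-multiple : ∀ a {f : A → ℤ} → (∀ x → ∃ λ z → f x ≡ a * z) → ∀ xs → ∃ λ z → count f xs ≡ a * z
count-multiple a f∈aℤ [] = 0ℤ , sym (ℤ.*-zeroʳ a)
count-multiple a f∈aℤ (x ∷ xs) with f∈aℤ x | count-multiple a f∈aℤ xs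
... | z , fx≡az | w , sum≡aw = z + w , trans (cong₂ _+_ fx≡az sum≡aw) (sym (ℤ.*-distribˡ-+ a z w))

count-≡0-or-witness : ∀ {P : A → Set} (f : A → ℤ) → (∀ x → f x ≡ 0ℤ ⊎ P x) →
                        ∀ xs → count f xs ≡ 0ℤ ⊎ ∃ P
count-≡0-or-witness f f0⊎P [] = inj₁ refl
count-≡0-or-witness f f0⊎P (x ∷ xs) with f0⊎P x | count-≡0-or-witness f f0⊎P xs
... | inj₂ px   | _         = inj₂ (x , px)
... | inj₁ _    | inj₂ p    = inj₂ p
... | inj₁ fx≡0 | inj₁ xs≡0 = inj₁ (cong₂ _+_ fx≡0 xs≡0)

+sumℕ : ∀ xs → + sumℕ xs ≡ count +_ xs
+sumℕ []       = refl
+sumℕ (x ∷ xs) = trans (ℤ.pos-+ x _) (cong (_+_ (+ x)) (+sumℕ xs))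

+sumℕ-map : ∀ (f : A → ℕ) xs → + sumℕ (map f xs) ≡ count (+_ ∘ f) xs
+sumℕ-map f xs = trans (+sumℕ (map f xs)) (count-map +_ f xs)

indℤ-yes : (P? : Dec P) → P → indℤ P? ≡ 1ℤ
indℤ-yes (yes _) _ = refl
indℤ-yes (no ¬p) p = ⊥-elim (¬p p)

indℤ-no : (P? : Dec P) → ¬ P → indℤ P? ≡ 0ℤ
indℤ-no (yes p) ¬p = ⊥-elim (¬p p)
indℤ-no (no _)  _  = refl

indℤ-cong : (P? : Dec P) (Q? : Dec Q) → (P → Q) → (Q → P) → indℤ P? ≡ indℤ Q?
indℤ-cong (yes _) (yes _) _   _   = refl
indℤ-cong (yes p) (no ¬q) p→q _   = ⊥-elim (¬q (p→q p))
indℤ-cong (no ¬p) (yes q) _   q→p = ⊥-elim (¬p (q→p q))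
indℤ-cong (no _)  (no _)  _   _   = refl

indℤ-× : (P? : Dec P) (Q? : Dec Q) → indℤ (P? ×-dec Q?) ≡ indℤ P? * indℤ Q?
indℤ-× (yes _) (yes _) = refl
indℤ-× (yes _) (no _)  = refl
indℤ-× (no _)  (yes _) = refl
indℤ-× (no _)  (no _)  = refl

indℤ-*-cong : ∀ (P? : Dec P) {a b} → (P → a ≡ b) → indℤ P? * a ≡ indℤ P? * b
indℤ-*-cong (yes p) a≡b = cong (1ℤ *_) (a≡b p)
indℤ-*-cong (no _)  {a} {b} _ = trans (ℤ.*-zeroˡ a) (sym (ℤ.*-zeroˡ b))

indℤ-mono-≤ : (P? : Dec P) (Q? : Dec Q) → (P → Q) → indℤ P? ≤ indℤ Q?
indℤ-mono-≤ (yes p) (yes _) _   = ℤ.≤-refl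
indℤ-mono-≤ (yes p) (no ¬q) p→q = ⊥-elim (¬q (p→q p))
indℤ-mono-≤ (no _)  (yes _) _   = ℤ.+≤+ ℕ.z≤n
indℤ-mono-≤ (no _)  (no _)  _   = ℤ.≤-refl

1≤⇒+suc : ∀ {z} → 1ℤ ≤ z → ∃ λ k → z ≡ + suc k
1≤⇒+suc {+ zero}  (ℤ.+≤+ ())
1≤⇒+suc {+ suc k} _ = k , refl

module Enumeration (S : DecSetoid 0ℓ 0ℓ) where

  open DecSetoid S using (Carrier; _≈_; _≟_) renaming (sym to ≈-sym)

  multiplicity : Carrier → List Carrier → ℤ
  multiplicity x = count (λ y → indℤ (x ≟ y))

  Enumerates : List Carrier → Set
  Enumerates U = ∀ x → multiplicity x U ≡ 1ℤ

  module _ (U : List Carrier) (U-enum : Enumerates U) {f : Carrier → ℤ} (f-cong : f Preserves _≈_ ⟶ _≡_) where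

    count-by-multiplicity : ∀ L → count f L ≡ count (λ u → multiplicity u L * f u) U
    count-by-multiplicity L = begin
      count f L                                            ≡˘⟨ count-cong (λ x → trans (cong (f x *_) (U-enum x)) (ℤ.*-identityʳ (f x))) L ⟩
      count (λ x → f x * count (λ u → indℤ (x ≟ u)) U) L    ≡˘⟨ count-cong (λ x → count-*ˡ (f x) _ U) L ⟩
      count (λ x → count (λ u → f x * indℤ (x ≟ u)) U) L    ≡⟨ count-cong (λ x → count-cong (weight-swap x) U) L ⟩
      count (λ x → count (λ u → indℤ (u ≟ x) * f u) U) L    ≡⟨ count-swap (λ x u → indℤ (u ≟ x) * f u) L U ⟩
      count (λ u → count (λ x → indℤ (u ≟ x) * f u) L) U    ≡⟨ count-cong (λ u → count-*ʳ (f u) _ L) U ⟩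
      count (λ u → multiplicity u L * f u) U                ∎
      where
      open ≡-Reasoning
      weight-swap : ∀ x u → f x * indℤ (x ≟ u) ≡ indℤ (u ≟ x) * f u
      weight-swap x u with x ≟ u | u ≟ x
      ... | yes x≈u | yes _   = trans (ℤ.*-identityʳ (f x)) (trans (f-cong x≈u) (sym (ℤ.*-identityˡ (f u))))
      ... | yes x≈u | no u≉x  = ⊥-elim (u≉x (≈-sym x≈u))
      ... | no x≉u  | yes u≈x = ⊥-elim (x≉u (≈-sym u≈x))
      ... | no _    | no _    = ℤ.*-zeroʳ (f x)

    count-enumeration : ∀ L → Enumerates L → count f L ≡ count f U
    count-enumeration L L-enum = begin
      count f L                                ≡⟨ count-by-multiplicity L ⟩
      count (λ u → multiplicity u L * f u) U    ≡⟨ count-cong (λ u → trans (cong (_* f u) (L-enum u)) (ℤ.*-identityˡ (f u))) U ⟩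
      count f U                                ∎
      where open ≡-Reasoning

open Enumeration using (Enumerates)

module _ (S S′ : DecSetoid 0ℓ 0ℓ) where

  private
    module S  = DecSetoid S
    module S′ = DecSetoid S′
    open Enumeration

  map-enumerates : ∀ U (to : S.Carrier → S′.Carrier) (from : S′.Carrier → S.Carrier) →
                   to Preserves S._≈_ ⟶ S′._≈_ → from Preserves S′._≈_ ⟶ S._≈_ →
                   (∀ x → to (from x) S′.≈ x) → (∀ x → from (to x) S.≈ x) →
                   Enumerates S U → Enumerates S′ (map to U)
  map-enumerates U to from to-cong from-cong to∘from from∘to U-enum y =
    trans (count-map (λ z → indℤ (y S′.≟ z)) to U)
          (trans (count-cong (λ u → indℤ-cong (y S′.≟ to u) (from y S.≟ u) y≈to⇒from≈ from≈⇒y≈to) U)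
                 (U-enum (from y)))
    where
    y≈to⇒from≈ : ∀ {u} → y S′.≈ to u → from y S.≈ u
    y≈to⇒from≈ y≈tu = S.trans (from-cong y≈tu) (from∘to _)
    from≈⇒y≈to : ∀ {u} → from y S.≈ u → y S′.≈ to u
    from≈⇒y≈to fy≈u = S′.trans (S′.sym (to∘from y)) (to-cong fy≈u)

module _ (S : DecSetoid 0ℓ 0ℓ) where

  private
    module S = DecSetoid S

  count-reindex : ∀ U (to from : S.Carrier → S.Carrier) →
                  to Preserves S._≈_ ⟶ S._≈_ → from Preserves S._≈_ ⟶ S._≈_ →
                  (∀ x → to (from x) S.≈ x) → (∀ x → from (to x) S.≈ x) → Enumerates S U →
                  ∀ {f} → f Preserves S._≈_ ⟶ _≡_ → count (f ∘ to) U ≡ count f U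
  count-reindex U to from to-cong from-cong to∘from from∘to U-enum {f} f-cong =
    trans (sym (count-map f to U))
          (Enumeration.count-enumeration S U U-enum f-cong (map to U)
            (map-enumerates S S U to from to-cong from-cong to∘from from∘to U-enum))

FunDecSetoid : ℕ → ℕ → DecSetoid 0ℓ 0ℓ
FunDecSetoid k n = Pointwise.decSetoid (Fin.≡-decSetoid n) k

count-allFin-suc : ∀ n (f : Fin (suc n) → ℤ) → count f (allFin (suc n)) ≡ f Fin.zero + count (f ∘ Fin.suc) (allFin n)
count-allFin-suc n f = cong (_+_ (f Fin.zero))
  (trans (cong (count f) (sym (List.map-tabulate id Fin.suc))) (count-map f Fin.suc (allFin n)))

allFin-enumerates : ∀ n → Enumerates (Fin.≡-decSetoid n) (allFin n)
allFin-enumerates (suc n) Fin.zero =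
  trans (count-allFin-suc n (λ i → indℤ (Fin.zero ≟F i))) (cong (_+_ 1ℤ) (count-zero (λ _ → refl) (allFin n)))
allFin-enumerates (suc n) (Fin.suc x) = begin
  count (λ i → indℤ (Fin.suc x ≟F i)) (allFin (suc n))        ≡⟨ count-allFin-suc n (λ i → indℤ (Fin.suc x ≟F i)) ⟩
  0ℤ + count (λ i → indℤ (Fin.suc x ≟F Fin.suc i)) (allFin n)  ≡⟨ ℤ.+-identityˡ _ ⟩
  count (λ i → indℤ (Fin.suc x ≟F Fin.suc i)) (allFin n)       ≡⟨ count-cong suc≟suc (allFin n) ⟩
  count (λ i → indℤ (x ≟F i)) (allFin n)                       ≡⟨ allFin-enumerates n x ⟩
  1ℤ                                                              ∎
  where
  open ≡-Reasoning
  suc≟suc : ∀ i → indℤ (Fin.suc x ≟F Fin.suc i) ≡ indℤ (x ≟F i)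
  suc≟suc i = indℤ-cong (Fin.suc x ≟F Fin.suc i) (x ≟F i) Fin.suc-injective (cong Fin.suc)

allFuns-enumerates : ∀ {n} k → Enumerates (FunDecSetoid k n) (allFuns k)
allFuns-enumerates zero    x = indℤ-yes (DecSetoid._≟_ (FunDecSetoid 0 _) x (λ ())) (λ ())
allFuns-enumerates {n} (suc k) x = begin
  count (λ y → indℤ (x ≟ y)) (concatMap cons-all (allFuns k))                      ≡⟨ count-concatMap _ cons-all (allFuns k) ⟩
  count (λ f → count (λ y → indℤ (x ≟ y)) (cons-all f)) (allFuns k)                ≡⟨ count-cong (λ f → count-map _ (_◂ f) (allFin n)) (allFuns k) ⟩
  count (λ f → count (λ a → indℤ (x ≟ (a ◂ f))) (allFin n)) (allFuns k)           ≡⟨ count-cong (λ f → count-cong (split f) (allFin n)) (allFuns k) ⟩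
  count (λ f → count (λ a → indℤ (head ≟F a) * indℤ (tail ≟ f)) (allFin n)) (allFuns k) ≡⟨ count-cong (λ f → count-*ʳ _ _ (allFin n)) (allFuns k) ⟩
  count (λ f → count (λ a → indℤ (head ≟F a)) (allFin n) * indℤ (tail ≟ f)) (allFuns k) ≡⟨ count-cong (λ f → cong (_* indℤ (tail ≟ f)) (allFin-enumerates n head)) (allFuns k) ⟩
  count (λ f → 1ℤ * indℤ (tail ≟ f)) (allFuns k)                                  ≡⟨ count-cong (λ f → ℤ.*-identityˡ _) (allFuns k) ⟩
  count (λ f → indℤ (tail ≟ f)) (allFuns k)                                        ≡⟨ allFuns-enumerates k tail ⟩
  1ℤ                                                                               ∎
  where
  open ≡-Reasoning
  _≟_ : ∀ {m} → Decidable (DecSetoid._≈_ (FunDecSetoid m n))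
  _≟_ = DecSetoid._≟_ (FunDecSetoid _ n)
  cons-all : (Fin k → Fin n) → List (Fin (suc k) → Fin n)
  cons-all f = map (_◂ f) (allFin n)
  head : Fin n
  head = x Fin.zero
  tail : Fin k → Fin n
  tail = x ∘ Fin.suc
  split : ∀ f a → indℤ (x ≟ (a ◂ f)) ≡ indℤ (head ≟F a) * indℤ (tail ≟ f)
  split f a = trans (indℤ-cong (x ≟ (a ◂ f)) ((head ≟F a) ×-dec (tail ≟ f))
                               (λ x≈ → x≈ Fin.zero , x≈ ∘ Fin.suc)
                               (λ { (h≡ , t≈) Fin.zero → h≡ ; (h≡ , t≈) (Fin.suc i) → t≈ i }))
                    (indℤ-× (head ≟F a) (tail ≟ f))

count-allFin-< : ∀ {n} {f g : Fin n → ℤ} → (∀ k → f k ≤ g k) → ∀ i → f i < g i →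
                count f (allFin n) < count g (allFin n)
count-allFin-< {n} {f} {g} f≤g i fi<gi = ℤ.suc[i]≤j⇒i<j (begin
  1ℤ + count f (allFin n)                                     ≡⟨ ℤ.+-comm 1ℤ (count f (allFin n)) ⟩
  count f (allFin n) + 1ℤ                                     ≡˘⟨ cong (_+_ (count f (allFin n))) (allFin-enumerates n i) ⟩
  count f (allFin n) + count (λ k → indℤ (i ≟F k)) (allFin n) ≡˘⟨ count-+ f _ (allFin n) ⟩
  count (λ k → f k + indℤ (i ≟F k)) (allFin n)                ≤⟨ count-mono-≤ f+δᵢ≤g (allFin n) ⟩
  count g (allFin n)                                          ∎)
  where
  open ℤ.≤-Reasoning
  f+δᵢ≤g : ∀ k → f k + indℤ (i ≟F k) ≤ g k
  f+δᵢ≤g k with i ≟F k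
  ... | yes refl = subst (_≤ g i) (ℤ.+-comm 1ℤ (f i)) (ℤ.i<j⇒suc[i]≤j fi<gi)
  ... | no  _    = subst (_≤ g k) (sym (ℤ.+-identityʳ (f k))) (f≤g k)

module _ {n : ℕ} where

  isPerm-id : IsPerm {n} id
  isPerm-id _ _ eq = eq

  isPerm-∘ : ∀ {σ τ : Fin n → Fin n} → IsPerm σ → IsPerm τ → IsPerm (σ ∘ τ)
  isPerm-∘ σ-perm τ-perm i j eq = τ-perm i j (σ-perm _ _ eq)

  isPerm-cong : ∀ {σ τ : Fin n → Fin n} → σ ≗ τ → IsPerm σ → IsPerm τ
  isPerm-cong σ≗τ σ-perm i j eq = σ-perm i j (trans (σ≗τ i) (trans eq (sym (σ≗τ j))))

perm-surjective : ∀ {n} {σ : Fin n → Fin n} → IsPerm σ → ∀ j → ∃ λ i → σ i ≡ j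
perm-surjective {suc m} {σ} σ-perm j with Fin.any? (λ i → σ i ≟F j)
... | yes hit  = hit
... | no  miss = ⊥-elim (Fin.<⇒notInjective ℕ.≤-refl avoid-j-injective)
  where
  avoid-j : Fin (suc m) → Fin m
  avoid-j i = Fin.punchOut {i = j} (λ j≡σi → miss (i , sym j≡σi))
  avoid-j-injective : ∀ {a b} → avoid-j a ≡ avoid-j b → a ≡ b
  avoid-j-injective {a} {b} eq = σ-perm a b (Fin.punchOut-injective {i = j} _ _ eq)

module _ {n : ℕ} {σ : Fin n → Fin n} (σ-perm : IsPerm σ) where

  perm⁻¹ : Fin n → Fin n
  perm⁻¹ j = proj₁ (perm-surjective σ-perm j)

  perm∘perm⁻¹ : ∀ j → σ (perm⁻¹ j) ≡ j
  perm∘perm⁻¹ j = proj₂ (perm-surjective σ-perm j)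

  perm⁻¹∘perm : ∀ i → perm⁻¹ (σ i) ≡ i
  perm⁻¹∘perm i = σ-perm _ _ (perm∘perm⁻¹ (σ i))

  isPerm-perm⁻¹ : IsPerm perm⁻¹
  isPerm-perm⁻¹ a b eq = trans (sym (perm∘perm⁻¹ a)) (trans (cong σ eq) (perm∘perm⁻¹ b))

  count-allFin-perm : ∀ (f : Fin n → ℤ) → count (f ∘ σ) (allFin n) ≡ count f (allFin n)
  count-allFin-perm f = count-reindex (Fin.≡-decSetoid n) (allFin n) σ perm⁻¹ (cong σ) (cong perm⁻¹)
                          perm∘perm⁻¹ perm⁻¹∘perm (allFin-enumerates n) (cong f)

module _ {n : ℕ} {g : Fin n → Fin n} (g-perm : IsPerm g) {f : (Fin n → Fin n) → ℤ}
         (f-cong : f Preserves _≗_ ⟶ _≡_) where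

  private
    g⁻¹ : Fin n → Fin n
    g⁻¹ = perm⁻¹ g-perm

  count-allFuns-∘ˡ : count (λ σ → f (g ∘ σ)) (allFuns n) ≡ count f (allFuns n)
  count-allFuns-∘ˡ =
    count-reindex (FunDecSetoid n n) (allFuns n) (g ∘_) (g⁻¹ ∘_)
      (λ σ≗τ i → cong g (σ≗τ i)) (λ σ≗τ i → cong g⁻¹ (σ≗τ i))
      (λ σ i → perm∘perm⁻¹ g-perm (σ i)) (λ σ i → perm⁻¹∘perm g-perm (σ i))
      (allFuns-enumerates n) f-cong

  count-allFuns-conj : count (λ σ → f (g ∘ σ ∘ g⁻¹)) (allFuns n) ≡ count f (allFuns n)
  count-allFuns-conj =
    count-reindex (FunDecSetoid n n) (allFuns n) (λ σ → g ∘ σ ∘ g⁻¹) (λ σ → g⁻¹ ∘ σ ∘ g)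
      (λ σ≗τ i → cong g (σ≗τ (g⁻¹ i))) (λ σ≗τ i → cong g⁻¹ (σ≗τ (g i)))
      (λ σ i → trans (perm∘perm⁻¹ g-perm _) (cong σ (perm∘perm⁻¹ g-perm i)))
      (λ σ i → trans (perm⁻¹∘perm g-perm _) (cong σ (perm⁻¹∘perm g-perm i)))
      (allFuns-enumerates n) f-cong

totalDeg-∘perm : ∀ {n} (y : Mono n) {σ} → IsPerm σ → totalDeg (y ∘ σ) ≡ totalDeg y
totalDeg-∘perm {n} y {σ} σ-perm = ℤ.+-injective (begin
  + totalDeg (y ∘ σ)                 ≡⟨ +sumℕ-map (y ∘ σ) (allFin n) ⟩
  count (+_ ∘ y ∘ σ) (allFin n)      ≡⟨ count-allFin-perm σ-perm (+_ ∘ y) ⟩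
  count (+_ ∘ y) (allFin n)          ≡˘⟨ +sumℕ-map y (allFin n) ⟩
  + totalDeg y                       ∎)
  where open ≡-Reasoning

count-filter-allPerms : ∀ {n} {Q : (Fin n → Fin n) → Set} (Q? : ∀ σ → Dec (Q σ)) → (∀ σ → Q σ → IsPerm σ) →
                        ∀ h → count h (filter Q? (allPerms n)) ≡ count (λ σ → indℤ (Q? σ) * h σ) (allFuns n)
count-filter-allPerms {n} Q? Q⇒perm h =
  trans (count-filter Q? h (allPerms n)) (trans (count-filter isPerm? _ (allFuns n)) (count-cong drop-isPerm (allFuns n)))
  where
  drop-isPerm : ∀ σ → indℤ (isPerm? σ) * (indℤ (Q? σ) * h σ) ≡ indℤ (Q? σ) * h σ
  drop-isPerm σ with Q? σ
  ... | yes q = trans (cong (_* (1ℤ * h σ)) (indℤ-yes (isPerm? σ) (Q⇒perm σ q))) (ℤ.*-identityˡ _)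
  ... | no  _ = ℤ.*-zeroʳ (indℤ (isPerm? σ))

-- Tableau.InR and Tableau.InC are PreservesLabel rowOf and PreservesLabel colOf.
module _ {n : ℕ} (label : Fin n → ℕ) where

  PreservesLabel : (Fin n → Fin n) → Set
  PreservesLabel σ = IsPerm σ × (∀ i → label (σ i) ≡ label i)

  preservesLabel-∘ : ∀ {g τ} → PreservesLabel g → PreservesLabel τ → PreservesLabel (g ∘ τ)
  preservesLabel-∘ (g-perm , g-label) (τ-perm , τ-label) = isPerm-∘ g-perm τ-perm , λ i → trans (g-label _) (τ-label i)

  preservesLabel-∘⁻ : ∀ {g τ} → PreservesLabel g → PreservesLabel (g ∘ τ) → PreservesLabel τ
  preservesLabel-∘⁻ {g} (_ , g-label) (gτ-perm , gτ-label) =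
    (λ i j eq → gτ-perm i j (cong g eq)) , λ i → trans (sym (g-label _)) (gτ-label i)

  preservesLabel-cong : ∀ {σ τ} → σ ≗ τ → PreservesLabel σ → PreservesLabel τ
  preservesLabel-cong σ≗τ (σ-perm , σ-label) = isPerm-cong σ≗τ σ-perm , λ i → trans (cong label (sym (σ≗τ i))) (σ-label i)

  module _ (preservesLabel? : ∀ σ → Dec (PreservesLabel σ)) where

    χ : (Fin n → Fin n) → ℤ
    χ σ = indℤ (preservesLabel? σ)

    χ-cong : χ Preserves _≗_ ⟶ _≡_
    χ-cong {σ} {τ} σ≗τ = indℤ-cong (preservesLabel? σ) (preservesLabel? τ)
                                   (preservesLabel-cong σ≗τ) (preservesLabel-cong (sym ∘ σ≗τ))

    χ-∘ : ∀ {g} → PreservesLabel g → ∀ τ → χ (g ∘ τ) ≡ χ τ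
    χ-∘ g-pres τ = indℤ-cong (preservesLabel? _) (preservesLabel? τ) (preservesLabel-∘⁻ g-pres) (preservesLabel-∘ g-pres)

signOf : ℤ → ℤ
signOf z = negOnePow ℤ.∣ z ∣

negOnePow-+ : ∀ a b → negOnePow (a ℕ.+ b) ≡ negOnePow a * negOnePow b
negOnePow-+ zero    b = sym (ℤ.*-identityˡ _)
negOnePow-+ (suc a) b = trans (cong -_ (negOnePow-+ a b)) (ℤ.neg-distribˡ-* (negOnePow a) (negOnePow b))

negOnePow-square : ∀ a → negOnePow a * negOnePow a ≡ 1ℤ
negOnePow-square zero    = refl
negOnePow-square (suc a) = trans (solve 1 (λ x → (:- x) :* (:- x) := x :* x) refl (negOnePow a)) (negOnePow-square a)

signOf-⊖ : ∀ a b → signOf (a ℤ.⊖ b) ≡ negOnePow a * negOnePow b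
signOf-⊖ zero    zero    = refl
signOf-⊖ zero    (suc b) = sym (ℤ.*-identityˡ _)
signOf-⊖ (suc a) zero    = sym (ℤ.*-identityʳ _)
signOf-⊖ (suc a) (suc b) = begin
  signOf (suc a ℤ.⊖ suc b)          ≡⟨ cong signOf (ℤ.[1+m]⊖[1+n]≡m⊖n a b) ⟩
  signOf (a ℤ.⊖ b)                  ≡⟨ signOf-⊖ a b ⟩
  negOnePow a * negOnePow b         ≡⟨ solve 2 (λ x y → x :* y := (:- x) :* (:- y)) refl (negOnePow a) (negOnePow b) ⟩
  negOnePow (suc a) * negOnePow (suc b) ∎
  where open ≡-Reasoning

signOf-+ : ∀ x y → signOf (x + y) ≡ signOf x * signOf y
signOf-+ (+ m)    (+ n)    = negOnePow-+ m n
signOf-+ (+ m)    -[1+ n ] = signOf-⊖ m (suc n)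
signOf-+ -[1+ m ] (+ n)    = trans (signOf-⊖ n (suc m)) (ℤ.*-comm (negOnePow n) (negOnePow (suc m)))
signOf-+ -[1+ m ] -[1+ n ] = trans (cong (negOnePow ∘ suc) (sym (ℕ.+-suc m n))) (negOnePow-+ (suc m) (suc n))

signOf-double : ∀ x → signOf (x + x) ≡ 1ℤ
signOf-double x = trans (signOf-+ x x) (negOnePow-square ℤ.∣ x ∣)

sgn-square : ∀ {n} (σ : Fin n → Fin n) → sgn σ * sgn σ ≡ 1ℤ
sgn-square σ = negOnePow-square ℤ.∣ inversions σ ∣

module _ {n : ℕ} where

  Σ² : (Fin n → Fin n → ℤ) → ℤ
  Σ² h = count (λ i → count (h i) (allFin n)) (allFin n)

  Σ²-cong : ∀ {h h′ : Fin n → Fin n → ℤ} → (∀ i j → h i j ≡ h′ i j) → Σ² h ≡ Σ² h′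
  Σ²-cong h≗h′ = count-cong (λ i → count-cong (h≗h′ i) (allFin n)) (allFin n)

  Σ²-+ : ∀ (h h′ : Fin n → Fin n → ℤ) → Σ² (λ i j → h i j + h′ i j) ≡ Σ² h + Σ² h′
  Σ²-+ h h′ = trans (count-cong (λ i → count-+ (h i) (h′ i) (allFin n)) (allFin n)) (count-+ _ _ (allFin n))

  lt : Fin n → Fin n → ℤ
  lt i j = indℤ (i Fin.<? j)

  lt-irrefl : ∀ i → lt i i ≡ 0ℤ
  lt-irrefl i = indℤ-no (i Fin.<? i) (Fin.<-irrefl refl)

  lt-flip : ∀ {i j} → i ≢ j → lt j i ≡ 1ℤ - lt i j
  lt-flip {i} {j} i≢j with Fin.<-cmp i j
  ... | tri< i<j _ j≮i = trans (indℤ-no (j Fin.<? i) j≮i) (cong (_-_ 1ℤ) (sym (indℤ-yes (i Fin.<? j) i<j)))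
  ... | tri≈ _ i≡j _   = ⊥-elim (i≢j i≡j)
  ... | tri> i≮j _ j<i = trans (indℤ-yes (j Fin.<? i) j<i) (cong (_-_ 1ℤ) (sym (indℤ-no (i Fin.<? j) i≮j)))

  Σ²-symmetric : ∀ (f : Fin n → Fin n → ℤ) → (∀ i j → f i j ≡ f j i) → (∀ i → f i i ≡ 0ℤ) →
                 Σ² f ≡ Σ² (λ i j → lt i j * f i j) + Σ² (λ i j → lt i j * f i j)
  Σ²-symmetric f f-sym f-diag = begin
    Σ² f                                                      ≡⟨ Σ²-cong split ⟩
    Σ² (λ i j → lt i j * f i j + lt j i * f j i)              ≡⟨ Σ²-+ _ _ ⟩
    Σ² (λ i j → lt i j * f i j) + Σ² (λ i j → lt j i * f j i) ≡⟨ cong (_+_ (Σ² (λ i j → lt i j * f i j))) (count-swap (λ j i → lt i j * f i j) (allFin n) (allFin n)) ⟩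
    Σ² (λ i j → lt i j * f i j) + Σ² (λ i j → lt i j * f i j) ∎
    where
    open ≡-Reasoning
    split : ∀ i j → f i j ≡ lt i j * f i j + lt j i * f j i
    split i j with i ≟F j
    ... | yes refl = trans (f-diag i) (sym (cong₂ (λ x y → x * f i i + y * f i i) (lt-irrefl i) (lt-irrefl i)))
    ... | no i≢j   = sym (begin
      lt i j * f i j + lt j i * f j i         ≡⟨ cong₂ (λ x y → lt i j * f i j + x * y) (lt-flip i≢j) (sym (f-sym i j)) ⟩
      lt i j * f i j + (1ℤ - lt i j) * f i j  ≡⟨ solve 2 (λ a x → a :* x :+ (con 1ℤ :- a) :* x := x) refl (lt i j) (f i j) ⟩
      f i j                                   ∎)

  -- With a = [i<j], b = [τi<τj], c = [στj<στi] the defect a c − b c − a (1 − b) is symmetric in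
  -- (i, j) and vanishes on the diagonal, so inversions (σ ∘ τ) − inversions σ − inversions τ is even.
  sgn-∘ : ∀ {σ τ : Fin n → Fin n} → IsPerm σ → IsPerm τ → sgn (σ ∘ τ) ≡ sgn σ * sgn τ
  sgn-∘ {σ} {τ} σ-perm τ-perm = begin
    signOf (inversions (σ ∘ τ))                                       ≡⟨ cong signOf inversions-∘ ⟩
    signOf (inversions σ + inversions τ + (K + K))                    ≡⟨ signOf-+ (inversions σ + inversions τ) (K + K) ⟩
    signOf (inversions σ + inversions τ) * signOf (K + K)             ≡⟨ cong₂ _*_ (signOf-+ (inversions σ) (inversions τ)) (signOf-double K) ⟩
    sgn σ * sgn τ * 1ℤ                                                ≡⟨ ℤ.*-identityʳ _ ⟩
    sgn σ * sgn τ                                                     ∎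
    where
    open ≡-Reasoning
    a b c defect : Fin n → Fin n → ℤ
    a i j = lt i j
    b i j = lt (τ i) (τ j)
    c i j = lt (σ (τ j)) (σ (τ i))
    defect i j = a i j * c i j - b i j * c i j - a i j * (1ℤ - b i j)

    K : ℤ
    K = Σ² (λ i j → lt i j * defect i j)

    defect-sym : ∀ i j → defect i j ≡ defect j i
    defect-sym i j with i ≟F j
    ... | yes refl = refl
    ... | no i≢j = begin
      defect i j                                                          ≡⟨ solve 3 (λ x y z → x :* z :- y :* z :- x :* (con 1ℤ :- y) :=
                                                                               (con 1ℤ :- x) :* (con 1ℤ :- z) :- (con 1ℤ :- y) :* (con 1ℤ :- z)
                                                                               :- (con 1ℤ :- x) :* (con 1ℤ :- (con 1ℤ :- y))) refl (a i j) (b i j) (c i j) ⟩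
      (1ℤ - a i j) * (1ℤ - c i j) - (1ℤ - b i j) * (1ℤ - c i j)
        - (1ℤ - a i j) * (1ℤ - (1ℤ - b i j))                               ≡˘⟨ flip³ (lt-flip i≢j) (lt-flip (i≢j ∘ τ-perm _ _))
                                                                                    (lt-flip (i≢j ∘ sym ∘ τ-perm _ _ ∘ σ-perm _ _)) ⟩
      defect j i                                                          ∎
      where
      flip³ : ∀ {x x′ y y′ z z′} → x ≡ x′ → y ≡ y′ → z ≡ z′ →
              x * z - y * z - x * (1ℤ - y) ≡ x′ * z′ - y′ * z′ - x′ * (1ℤ - y′)
      flip³ refl refl refl = refl

    defect-diag : ∀ i → defect i i ≡ 0ℤ
    defect-diag i rewrite lt-irrefl i | lt-irrefl (τ i) = refl

    inversions-σ : inversions σ ≡ Σ² (λ i j → b i j * c i j)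
    inversions-σ = trans (sym (count-allFin-perm τ-perm _))
                         (count-cong (λ i → sym (count-allFin-perm τ-perm _)) (allFin n))

    inversions-τ : inversions τ ≡ Σ² (λ i j → a i j * (1ℤ - b i j))
    inversions-τ = Σ²-cong pointwise
      where
      pointwise : ∀ i j → lt i j * lt (τ j) (τ i) ≡ a i j * (1ℤ - b i j)
      pointwise i j with i ≟F j
      ... | yes refl rewrite lt-irrefl i = refl
      ... | no i≢j = cong (a i j *_) (lt-flip (i≢j ∘ τ-perm _ _))

    inversions-∘ : inversions (σ ∘ τ) ≡ inversions σ + inversions τ + (K + K)
    inversions-∘ = begin
      Σ² (λ i j → a i j * c i j)                                                       ≡⟨ Σ²-cong (λ i j → solve 3 (λ x y z → x :* z :=
                                                                                          (x :* z :- y :* z :- x :* (con 1ℤ :- y)) :+ y :* z :+ x :* (con 1ℤ :- y))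
                                                                                          refl (a i j) (b i j) (c i j)) ⟩
      Σ² (λ i j → defect i j + b i j * c i j + a i j * (1ℤ - b i j))                    ≡⟨ Σ²-+ _ _ ⟩
      Σ² (λ i j → defect i j + b i j * c i j) + Σ² (λ i j → a i j * (1ℤ - b i j))       ≡⟨ cong (_+ Σ² (λ i j → a i j * (1ℤ - b i j))) (Σ²-+ _ _) ⟩
      Σ² defect + Σ² (λ i j → b i j * c i j) + Σ² (λ i j → a i j * (1ℤ - b i j))         ≡˘⟨ cong₂ (λ x y → Σ² defect + x + y) inversions-σ inversions-τ ⟩
      Σ² defect + inversions σ + inversions τ                                           ≡⟨ cong (λ x → x + inversions σ + inversions τ) (Σ²-symmetric defect defect-sym defect-diag) ⟩
      K + K + inversions σ + inversions τ                                               ≡⟨ solve 3 (λ x y z → z :+ x :+ y := x :+ y :+ z) refl (inversions σ) (inversions τ) (K + K) ⟩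
      inversions σ + inversions τ + (K + K)                                             ∎

  sgn-cong : ∀ {σ τ : Fin n → Fin n} → σ ≗ τ → sgn σ ≡ sgn τ
  sgn-cong {σ} {τ} σ≗τ = cong signOf (Σ²-cong (λ i j → cong (lt i j *_)
    (indℤ-cong (σ j Fin.<? σ i) (τ j Fin.<? τ i) (subst₂ Fin._<_ (σ≗τ j) (σ≗τ i)) (subst₂ Fin._<_ (sym (σ≗τ j)) (sym (σ≗τ i))))))

  sgn-id : sgn {n} id ≡ 1ℤ
  sgn-id = cong signOf (trans (Σ²-cong lt-asym) (count-zero (λ _ → count-zero (λ _ → refl) (allFin n)) (allFin n)))
    where
    lt-asym : ∀ i j → lt i j * lt j i ≡ 0ℤ
    lt-asym i j with i Fin.<? j | j Fin.<? i
    ... | yes i<j | yes j<i = ⊥-elim (Fin.<-asym i<j j<i)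
    ... | yes _   | no _    = refl
    ... | no _    | yes _   = refl
    ... | no _    | no _    = refl

  sgn-conj : ∀ {g σ : Fin n → Fin n} (g-perm : IsPerm g) → IsPerm σ → sgn (g ∘ σ ∘ perm⁻¹ g-perm) ≡ sgn σ
  sgn-conj {g} {σ} g-perm σ-perm = begin
    sgn (g ∘ σ ∘ g⁻¹)           ≡⟨ sgn-∘ g-perm (isPerm-∘ σ-perm g⁻¹-perm) ⟩
    sgn g * sgn (σ ∘ g⁻¹)       ≡⟨ cong (sgn g *_) (sgn-∘ σ-perm g⁻¹-perm) ⟩
    sgn g * (sgn σ * sgn g⁻¹)   ≡⟨ solve 3 (λ x y z → x :* (y :* z) := y :* (x :* z)) refl (sgn g) (sgn σ) (sgn g⁻¹) ⟩
    sgn σ * (sgn g * sgn g⁻¹)   ≡˘⟨ cong (sgn σ *_) (sgn-∘ g-perm g⁻¹-perm) ⟩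
    sgn σ * sgn (g ∘ g⁻¹)       ≡⟨ cong (sgn σ *_) (trans (sgn-cong (perm∘perm⁻¹ g-perm)) sgn-id) ⟩
    sgn σ * 1ℤ                  ≡⟨ ℤ.*-identityʳ _ ⟩
    sgn σ                       ∎
    where
    open ≡-Reasoning
    g⁻¹ : Fin n → Fin n
    g⁻¹ = perm⁻¹ g-perm
    g⁻¹-perm : IsPerm g⁻¹
    g⁻¹-perm = isPerm-perm⁻¹ g-perm

argmax : ∀ {n} {Q : Fin n → Set} → (∀ i → Dec (Q i)) → (f : Fin n → ℕ) → ∀ {i₀} → Q i₀ →
         ∃ λ i → Q i × (∀ k → Q k → f k ℕ.≤ f i)
argmax {suc m} {Q} Q? f {i₀} q₀ with Fin.any? (Q? ∘ Fin.suc)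
argmax {suc m} {Q} Q? f {Fin.zero}  q₀ | no none = Fin.zero , q₀ , λ { Fin.zero _ → ℕ.≤-refl ; (Fin.suc k) qk → ⊥-elim (none (k , qk)) }
argmax {suc m} {Q} Q? f {Fin.suc i₀} q₀ | no none = ⊥-elim (none (i₀ , q₀))
... | yes (k₁ , q₁) with argmax (Q? ∘ Fin.suc) (f ∘ Fin.suc) q₁
... | i , qi , i-max with Q? Fin.zero | f Fin.zero ℕ.≤? f (Fin.suc i)
... | no ¬q₀ | _ = Fin.suc i , qi , λ { Fin.zero q → ⊥-elim (¬q₀ q) ; (Fin.suc k) qk → i-max k qk }
... | yes _  | yes f₀≤ = Fin.suc i , qi , λ { Fin.zero _ → f₀≤ ; (Fin.suc k) qk → i-max k qk }
... | yes q₀′ | no f₀≰ = Fin.zero , q₀′ , λ { Fin.zero _ → ℕ.≤-refl ; (Fin.suc k) qk → ℕ.≤-trans (i-max k qk) (ℕ.<⇒≤ (ℕ.≰⇒> f₀≰)) }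

reverse-map-upTo-suc : ∀ (a : ℕ → ℕ) L → reverse (map a (upTo (suc L))) ≡ a L ∷ reverse (map a (upTo L))
reverse-map-upTo-suc a L = begin
  reverse (map a (upTo (suc L)))         ≡˘⟨ cong (reverse ∘ map a) (List.upTo-∷ʳ L) ⟩
  reverse (map a (upTo L ++ L ∷ []))     ≡⟨ cong reverse (List.map-++ a (upTo L) (L ∷ [])) ⟩
  reverse (map a (upTo L) ++ a L ∷ [])   ≡⟨ List.reverse-++ (map a (upTo L)) (a L ∷ []) ⟩
  a L ∷ reverse (map a (upTo L))         ∎
  where open ≡-Reasoning

revLexGT-map-upTo : ∀ L (a b : ℕ → ℕ) j → j ℕ.< L → b j ℕ.< a j → (∀ k → j ℕ.< k → k ℕ.< L → a k ≡ b k) →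
                    RevLexGT (map a (upTo L)) (map b (upTo L))
revLexGT-map-upTo (suc L) a b j j<1+L bj<aj above
  rewrite reverse-map-upTo-suc a L | reverse-map-upTo-suc b L with ℕ.m≤n⇒m<n∨m≡n (ℕ.s≤s⁻¹ j<1+L)
... | inj₂ refl = inj₁ bj<aj
... | inj₁ j<L  = inj₂ (above L j<L ℕ.≤-refl ,
                        revLexGT-map-upTo L a b j j<L bj<aj (λ k j<k k<L → above k j<k (ℕ.m≤n⇒m≤1+n k<L)))

lookup≤head : ∀ (sh : List ℕ) → Linked ℕ._≥_ sh → ∀ r → List.lookup sh r ℕ.≤ List.foldr (λ a _ → a) 0 sh
lookup≤head (x ∷ xs)     _          Fin.zero    = ℕ.≤-refl
lookup≤head (x ∷ y ∷ xs) (x≥y ∷ xs↓) (Fin.suc r) = ℕ.≤-trans (lookup≤head (y ∷ xs) xs↓ r) x≥y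

BoxDecSetoid : List ℕ → DecSetoid 0ℓ 0ℓ
BoxDecSetoid sh = decSetoid (Product.≡-dec {B = λ r → Fin (List.lookup sh r)} _≟F_ _≟F_)

boxes : (sh : List ℕ) → List (Box sh)
boxes sh = concatMap (λ r → map (r ,_) (allFin (List.lookup sh r))) (allFin (List.length sh))

count-boxes : ∀ sh (f : Box sh → ℤ) →
              count f (boxes sh) ≡ count (λ r → count (λ c → f (r , c)) (allFin (List.lookup sh r))) (allFin (List.length sh))
count-boxes sh f = trans (count-concatMap f _ (allFin (List.length sh)))
                         (count-cong (λ r → count-map f (r ,_) (allFin (List.lookup sh r))) (allFin (List.length sh)))

boxes-enumerates : ∀ sh → Enumerates (BoxDecSetoid sh) (boxes sh)
boxes-enumerates sh (r₀ , c₀) = begin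
  count (λ b → indℤ ((r₀ , c₀) ≟B b)) (boxes sh)                                            ≡⟨ count-boxes sh (λ b → indℤ ((r₀ , c₀) ≟B b)) ⟩
  count (λ r → count (λ c → indℤ ((r₀ , c₀) ≟B (r , c))) (allFin (List.lookup sh r))) rows  ≡⟨ count-cong (row-sum r₀ c₀) rows ⟩
  count (λ r → indℤ (r₀ ≟F r)) rows                                                       ≡⟨ allFin-enumerates _ r₀ ⟩
  1ℤ                                                                                      ∎
  where
  open ≡-Reasoning
  _≟B_ : Decidable {A = Box sh} _≡_
  _≟B_ = DecSetoid._≟_ (BoxDecSetoid sh)
  rows : List (Fin (List.length sh))
  rows = allFin (List.length sh)
  row-sum : ∀ r₀ c₀ r → count (λ c → indℤ ((r₀ , c₀) ≟B (r , c))) (allFin (List.lookup sh r)) ≡ indℤ (r₀ ≟F r)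
  row-sum r₀ c₀ r = same-row? (r₀ ≟F r)
    where
    same-row? : ∀ {r} (r₀≟r : Dec (r₀ ≡ r)) → count (λ c → indℤ ((r₀ , c₀) ≟B (r , c))) (allFin (List.lookup sh r)) ≡ indℤ r₀≟r
    same-row? (yes refl) = trans (count-cong (λ c → indℤ-cong ((r₀ , c₀) ≟B (r₀ , c)) (c₀ ≟F c) (λ { refl → refl }) (cong (r₀ ,_)))
                                             (allFin (List.lookup sh r₀)))
                                 (allFin-enumerates _ c₀)
    same-row? {r} (no r₀≢r) = count-zero (λ c → indℤ-no ((r₀ , c₀) ≟B (r , c)) (r₀≢r ∘ cong proj₁)) (allFin (List.lookup sh r))

[n*z]/n≡z/1 : ∀ k z → (+ suc k * z) / suc k ≡ z / 1
[n*z]/n≡z/1 k z = ℚ.fromℚᵘ-cong {mkℚᵘ (+ suc k * z) k} {mkℚᵘ z 0}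
  (*≡* (solve 2 (λ a b → a :* b :* con (+ 1) := b :* a) refl (+ suc k) z))

[c*z]/n≡c/1*z/n : ∀ k c z → (c * z) / suc k ≡ (c / 1) ℚ.* (z / suc k)
[c*z]/n≡c/1*z/n k c z = ℚ.toℚᵘ-injective (ℚᵘ.≃-sym (ℚᵘ.≃-trans (ℚ.toℚᵘ-homo-* (c / 1) (z / suc k))
  (ℚᵘ.≃-trans (ℚᵘ.*-cong (ℚ.toℚᵘ-fromℚᵘ (mkℚᵘ c 0)) (ℚ.toℚᵘ-fromℚᵘ (mkℚᵘ z k)))
    (ℚᵘ.≃-trans (*≡* (solve 3 (λ a b d → a :* b :* d := a :* b :* (con (+ 1) :* d)) refl c z (+ suc k)))
      (ℚᵘ.≃-sym (ℚ.toℚᵘ-fromℚᵘ (mkℚᵘ (c * z) k)))))))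

module _ {n : ℕ} (sh : List ℕ) (T : Box sh ↔ Fin n) (M : Box sh → ℕ) where

  open Tableau sh T

  χR χC : (Fin n → Fin n) → ℤ
  χR = χ rowOf inR?
  χC = χ colOf inC?

  rowCount : Mono n → ℤ
  rowCount w = count (λ τ → indℤ (p M ≐? (w ∘ τ))) RList

  InRowOrbit : Mono n → Set
  InRowOrbit w = ∃ λ τ → InR τ × (p M ≗ w ∘ τ)

  rowTerm : Mono n → (Fin n → Fin n) → ℤ
  rowTerm w τ = χR τ * indℤ (p M ≐? (w ∘ τ))

  rowTerm-cong : ∀ w → rowTerm w Preserves _≗_ ⟶ _≡_
  rowTerm-cong w {τ} {τ′} τ≗τ′ = cong₂ _*_ (χ-cong rowOf inR? τ≗τ′)
    (indℤ-cong (p M ≐? (w ∘ τ)) (p M ≐? (w ∘ τ′)) (λ eq i → trans (eq i) (cong w (τ≗τ′ i)))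
                                                   (λ eq i → trans (eq i) (cong w (sym (τ≗τ′ i)))))

  rowCount-over-allFuns : ∀ w → rowCount w ≡ count (rowTerm w) (allFuns n)
  rowCount-over-allFuns w = count-filter-allPerms inR? (λ _ → proj₁) _

  rowCount-cong : ∀ {w w′} → w ≗ w′ → rowCount w ≡ rowCount w′
  rowCount-cong {w} {w′} w≗w′ = count-cong (λ τ → indℤ-cong (p M ≐? (w ∘ τ)) (p M ≐? (w′ ∘ τ))
    (λ eq i → trans (eq i) (w≗w′ (τ i))) (λ eq i → trans (eq i) (sym (w≗w′ (τ i))))) RList

  rowCount-∘R : ∀ w {g} → InR g → rowCount (w ∘ g) ≡ rowCount w
  rowCount-∘R w {g} g∈R = begin
    rowCount (w ∘ g)                                  ≡⟨ rowCount-over-allFuns (w ∘ g) ⟩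
    count (λ τ → χR τ * indℤ (p M ≐? (w ∘ g ∘ τ))) U   ≡˘⟨ count-cong (λ τ → cong (_* indℤ (p M ≐? (w ∘ g ∘ τ))) (χ-∘ rowOf inR? g∈R τ)) U ⟩
    count (λ τ → rowTerm w (g ∘ τ)) U                  ≡⟨ count-allFuns-∘ˡ (proj₁ g∈R) (rowTerm-cong w) ⟩
    count (rowTerm w) U                               ≡˘⟨ rowCount-over-allFuns w ⟩
    rowCount w                                        ∎
    where
    open ≡-Reasoning
    U : List (Fin n → Fin n)
    U = allFuns n

  rowCount-orbit : ∀ w → InRowOrbit w → rowCount w ≡ rowCount (p M)
  rowCount-orbit w (τ , τ∈R , p≗wτ) = trans (sym (rowCount-∘R w τ∈R)) (rowCount-cong (sym ∘ p≗wτ))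

  rowCount-off-orbit : ∀ w → rowCount w ≡ 0ℤ ⊎ InRowOrbit w
  rowCount-off-orbit w with count-≡0-or-witness (rowTerm w) term-off-orbit (allFuns n)
    where
    term-off-orbit : ∀ τ → rowTerm w τ ≡ 0ℤ ⊎ (InR τ × p M ≗ w ∘ τ)
    term-off-orbit τ with inR? τ | p M ≐? (w ∘ τ)
    ... | yes τ∈R | yes p≗wτ = inj₂ (τ∈R , p≗wτ)
    ... | yes _   | no _     = inj₁ refl
    ... | no _    | _        = inj₁ refl
  ... | inj₁ sum≡0 = inj₁ (trans (rowCount-over-allFuns w) sum≡0)
  ... | inj₂ orbit = inj₂ orbit

  rowCount-positive : ∃ λ k → rowCount (p M) ≡ + suc k
  rowCount-positive = 1≤⇒+suc (begin
    1ℤ                                                   ≡˘⟨ allFuns-enumerates n id ⟩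
    count (λ τ → indℤ (id ≟ τ)) (allFuns n)               ≤⟨ count-mono-≤ id-term≤ (allFuns n) ⟩
    count (rowTerm (p M)) (allFuns n)                     ≡˘⟨ rowCount-over-allFuns (p M) ⟩
    rowCount (p M)                                       ∎)
    where
    open ℤ.≤-Reasoning
    open DecSetoid (FunDecSetoid n n) using (_≟_)
    id-term≤ : ∀ τ → indℤ (id ≟ τ) ≤ rowTerm (p M) τ
    id-term≤ τ = ℤ.≤-trans (indℤ-mono-≤ (id ≟ τ) (inR? τ ×-dec (p M ≐? (p M ∘ τ)))
                             (λ id≗τ → preservesLabel-cong rowOf id≗τ (isPerm-id , λ _ → refl) , λ i → cong (p M) (id≗τ i)))
                           (ℤ.≤-reflexive (indℤ-× (inR? τ) (p M ≐? (p M ∘ τ))))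

  F≡εp/[1+k] : ∀ {k} → rowCount (p M) ≡ + suc k → ∀ y → F M y ≡ εp M y / suc k
  F≡εp/[1+k] {k} rowCount≡1+k y = divide (cong ℤ.∣_∣ rowCount≡1+k)
    where
    divide : ∀ {m} → m ≡ suc k → divℚ M (εp M y) m ≡ εp M y / suc k
    divide refl = refl

  columnTerm : Mono n → (Fin n → Fin n) → ℤ
  columnTerm y σ = χC σ * (sgn σ * rowCount (y ∘ σ))

  columnTerm-cong : ∀ y → columnTerm y Preserves _≗_ ⟶ _≡_
  columnTerm-cong y σ≗σ′ = cong₂ _*_ (χ-cong colOf inC? σ≗σ′) (cong₂ _*_ (sgn-cong σ≗σ′) (rowCount-cong (cong y ∘ σ≗σ′)))

  εp≡column-sum : ∀ y → εp M y ≡ count (λ σ → sgn σ * rowCount (y ∘ σ)) CList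
  εp≡column-sum y = count-cong (λ σ → count-*ˡ (sgn σ) _ RList) CList

  εp-over-allFuns : ∀ y → εp M y ≡ count (columnTerm y) (allFuns n)
  εp-over-allFuns y = trans (εp≡column-sum y) (count-filter-allPerms inC? (λ _ → proj₁) _)

  εp-multiple-of-rowCount : ∀ y → ∃ λ z → εp M y ≡ rowCount (p M) * z
  εp-multiple-of-rowCount y =
    let z , sum≡ = count-multiple (rowCount (p M)) term-multiple CList in z , trans (εp≡column-sum y) sum≡
    where
    term-multiple : ∀ σ → ∃ λ z → sgn σ * rowCount (y ∘ σ) ≡ rowCount (p M) * z
    term-multiple σ with rowCount-off-orbit (y ∘ σ)
    ... | inj₁ none  = 0ℤ , trans (cong (sgn σ *_) none) (trans (ℤ.*-zeroʳ (sgn σ)) (sym (ℤ.*-zeroʳ (rowCount (p M)))))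
    ... | inj₂ orbit = sgn σ , trans (cong (sgn σ *_) (rowCount-orbit (y ∘ σ) orbit)) (ℤ.*-comm (sgn σ) _)

  εp-∘C : ∀ y {g} → InC g → εp M (y ∘ g) ≡ sgn g * εp M y
  εp-∘C y {g} g∈C@(g-perm , _) = begin
    εp M (y ∘ g)                        ≡˘⟨ ℤ.*-identityˡ _ ⟩
    1ℤ * εp M (y ∘ g)                   ≡˘⟨ cong (_* εp M (y ∘ g)) (sgn-square g) ⟩
    sgn g * sgn g * εp M (y ∘ g)        ≡⟨ ℤ.*-assoc (sgn g) (sgn g) _ ⟩
    sgn g * (sgn g * εp M (y ∘ g))      ≡˘⟨ cong (sgn g *_) εp≡sgn*εp∘ ⟩
    sgn g * εp M y                      ∎
    where
    open ≡-Reasoning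
    translate : ∀ σ → columnTerm y (g ∘ σ) ≡ sgn g * columnTerm (y ∘ g) σ
    translate σ = begin
      χC (g ∘ σ) * (sgn (g ∘ σ) * rowCount (y ∘ g ∘ σ))  ≡⟨ cong (_* (sgn (g ∘ σ) * rowCount (y ∘ g ∘ σ))) (χ-∘ colOf inC? g∈C σ) ⟩
      χC σ * (sgn (g ∘ σ) * rowCount (y ∘ g ∘ σ))        ≡⟨ indℤ-*-cong (inC? σ) (λ (σ-perm , _) → cong (_* rowCount (y ∘ g ∘ σ)) (sgn-∘ g-perm σ-perm)) ⟩
      χC σ * (sgn g * sgn σ * rowCount (y ∘ g ∘ σ))      ≡⟨ solve 4 (λ c a b w → c :* (a :* b :* w) := a :* (c :* (b :* w))) refl
                                                             (χC σ) (sgn g) (sgn σ) (rowCount (y ∘ g ∘ σ)) ⟩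
      sgn g * columnTerm (y ∘ g) σ                      ∎
    εp≡sgn*εp∘ : εp M y ≡ sgn g * εp M (y ∘ g)
    εp≡sgn*εp∘ = begin
      εp M y                                          ≡⟨ εp-over-allFuns y ⟩
      count (columnTerm y) (allFuns n)                ≡˘⟨ count-allFuns-∘ˡ g-perm (columnTerm-cong y) ⟩
      count (columnTerm y ∘ (g ∘_)) (allFuns n)       ≡⟨ count-cong translate (allFuns n) ⟩
      count (λ σ → sgn g * columnTerm (y ∘ g) σ) (allFuns n) ≡⟨ count-*ˡ (sgn g) _ (allFuns n) ⟩
      sgn g * count (columnTerm (y ∘ g)) (allFuns n)  ≡˘⟨ cong (sgn g *_) (εp-over-allFuns (y ∘ g)) ⟩
      sgn g * εp M (y ∘ g)                            ∎

  conj-∈C : ∀ {h h′ σ} → (∀ a b → colOf a ≡ colOf b → colOf (h a) ≡ colOf (h b)) → (∀ k → h (h′ k) ≡ k) →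
            IsPerm h → IsPerm h′ → InC σ → InC (h ∘ σ ∘ h′)
  conj-∈C {h} {h′} {σ} h-cols h∘h′ h-perm h′-perm (σ-perm , σ-col) =
    isPerm-∘ h-perm (isPerm-∘ σ-perm h′-perm) ,
    λ k → trans (h-cols _ _ (σ-col (h′ k))) (cong colOf (h∘h′ k))

  module _ {g : Fin n → Fin n} (g∈R : InR g) (g-cols : ColPermuting g) where

    private
      g-perm : IsPerm g
      g-perm = proj₁ g∈R
      g⁻¹ : Fin n → Fin n
      g⁻¹ = perm⁻¹ g-perm

    g-keeps-columns : ∀ a b → colOf a ≡ colOf b → colOf (g a) ≡ colOf (g b)
    g-keeps-columns a b a~b with g-cols a
    ... | _ , into , _ = trans (into a refl) (sym (into b (sym a~b)))

    g⁻¹-keeps-columns : ∀ a b → colOf a ≡ colOf b → colOf (g⁻¹ a) ≡ colOf (g⁻¹ b)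
    g⁻¹-keeps-columns a b a~b with g-cols (g⁻¹ a)
    ... | _ , into , onto with onto b (trans (sym a~b) (trans (cong colOf (sym (perm∘perm⁻¹ g-perm a))) (into _ refl)))
    ... | k , k~g⁻¹a , gk≡b = trans (sym k~g⁻¹a) (cong colOf (trans (sym (perm⁻¹∘perm g-perm k)) (cong g⁻¹ gk≡b)))

    χC-conj : ∀ σ → χC σ ≡ χC (g ∘ σ ∘ g⁻¹)
    χC-conj σ = indℤ-cong (inC? σ) (inC? (g ∘ σ ∘ g⁻¹))
      (conj-∈C g-keeps-columns (perm∘perm⁻¹ g-perm) g-perm (isPerm-perm⁻¹ g-perm))
      (preservesLabel-cong colOf (λ i → trans (perm⁻¹∘perm g-perm _) (cong σ (perm⁻¹∘perm g-perm i)))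
        ∘ conj-∈C g⁻¹-keeps-columns (perm⁻¹∘perm g-perm) (isPerm-perm⁻¹ g-perm) g-perm)

    εp-∘R : ∀ y → εp M (y ∘ g) ≡ εp M y
    εp-∘R y = begin
      εp M (y ∘ g)                                           ≡⟨ εp-over-allFuns (y ∘ g) ⟩
      count (columnTerm (y ∘ g)) (allFuns n)                 ≡⟨ count-cong conjugate (allFuns n) ⟩
      count (λ σ → columnTerm y (g ∘ σ ∘ g⁻¹)) (allFuns n)   ≡⟨ count-allFuns-conj g-perm (columnTerm-cong y) ⟩
      count (columnTerm y) (allFuns n)                       ≡˘⟨ εp-over-allFuns y ⟩
      εp M y                                                 ∎
      where
      open ≡-Reasoning
      rowCount-conj : ∀ σ → rowCount (y ∘ g ∘ σ) ≡ rowCount (y ∘ (g ∘ σ ∘ g⁻¹))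
      rowCount-conj σ = trans (rowCount-cong (λ i → cong (y ∘ g ∘ σ) (sym (perm⁻¹∘perm g-perm i))))
                              (rowCount-∘R (y ∘ (g ∘ σ ∘ g⁻¹)) g∈R)
      conjugate : ∀ σ → columnTerm (y ∘ g) σ ≡ columnTerm y (g ∘ σ ∘ g⁻¹)
      conjugate σ = trans (indℤ-*-cong (inC? σ) (λ (σ-perm , _) → cong₂ _*_ (sym (sgn-conj g-perm σ-perm)) (rowCount-conj σ)))
                          (cong (_* (sgn (g ∘ σ ∘ g⁻¹) * rowCount (y ∘ (g ∘ σ ∘ g⁻¹)))) (χC-conj σ))

  εp-equivariant : ∀ {g} (d : InCt g) y → εp M (y ∘ g) ≡ sgnTilde d * εp M y
  εp-equivariant (genC g∈C)         y = εp-∘C y g∈C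
  εp-equivariant (genR g∈R g-cols)  y = trans (εp-∘R g∈R g-cols y) (sym (ℤ.*-identityˡ _))
  εp-equivariant (comp {g} {h} d e) y = begin
    εp M (y ∘ g ∘ h)                      ≡⟨ εp-equivariant e (y ∘ g) ⟩
    sgnTilde e * εp M (y ∘ g)              ≡⟨ cong (sgnTilde e *_) (εp-equivariant d y) ⟩
    sgnTilde e * (sgnTilde d * εp M y)     ≡⟨ solve 3 (λ a b c → a :* (b :* c) := b :* a :* c) refl (sgnTilde e) (sgnTilde d) (εp M y) ⟩
    sgnTilde d * sgnTilde e * εp M y       ∎
    where open ≡-Reasoning

  totalDeg-p : totalDeg (p M) ≡ entrySum sh M
  totalDeg-p = ℤ.+-injective (begin
    + totalDeg (p M)                                            ≡⟨ +sumℕ-map (M ∘ from) (allFin n) ⟩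
    count (+_ ∘ M ∘ from) (allFin n)                            ≡˘⟨ count-map (+_ ∘ M) from (allFin n) ⟩
    count (+_ ∘ M) (map from (allFin n))                        ≡⟨ Enumeration.count-enumeration (BoxDecSetoid sh) (boxes sh) (boxes-enumerates sh)
                                                                     (cong (+_ ∘ M)) (map from (allFin n)) from-enumerates ⟩
    count (+_ ∘ M) (boxes sh)                                   ≡⟨ count-boxes sh (+_ ∘ M) ⟩
    count (λ r → count (λ c → + M (r , c)) (row r)) rows        ≡˘⟨ count-cong (λ r → count-map +_ (λ c → M (r , c)) (row r)) rows ⟩
    count (λ r → count +_ (map (λ c → M (r , c)) (row r))) rows ≡˘⟨ count-concatMap +_ (λ r → map (λ c → M (r , c)) (row r)) rows ⟩
    count +_ (concatMap (λ r → map (λ c → M (r , c)) (row r)) rows) ≡˘⟨ +sumℕ (concatMap (λ r → map (λ c → M (r , c)) (row r)) rows) ⟩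
    + entrySum sh M                                             ∎)
    where
    open ≡-Reasoning
    open Inverse T using (to; from; strictlyInverseˡ; strictlyInverseʳ)
    rows : List (Fin (List.length sh))
    rows = allFin (List.length sh)
    row : (r : Fin (List.length sh)) → List (Fin (List.lookup sh r))
    row r = allFin (List.lookup sh r)
    from-enumerates : Enumerates (BoxDecSetoid sh) (map from (allFin n))
    from-enumerates = map-enumerates (Fin.≡-decSetoid n) (BoxDecSetoid sh) (allFin n) from to (cong from) (cong to)
                        strictlyInverseʳ strictlyInverseˡ (allFin-enumerates n)

  εp-homogeneous : ∀ y → totalDeg y ≢ entrySum sh M → εp M y ≡ 0ℤ
  εp-homogeneous y deg≢ = trans (εp-over-allFuns y) (count-zero term-vanishes (allFuns n))
    where
    term-vanishes : ∀ σ → columnTerm y σ ≡ 0ℤ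
    term-vanishes σ = trans (indℤ-*-cong (inC? σ) off-orbit) (ℤ.*-zeroʳ (χC σ))
      where
      off-orbit : InC σ → sgn σ * rowCount (y ∘ σ) ≡ 0ℤ
      off-orbit (σ-perm , _) with rowCount-off-orbit (y ∘ σ)
      ... | inj₁ none = trans (cong (sgn σ *_) none) (ℤ.*-zeroʳ (sgn σ))
      ... | inj₂ (τ , (τ-perm , _) , p≗yστ) = ⊥-elim (deg≢ (begin
        totalDeg y               ≡˘⟨ totalDeg-∘perm y (isPerm-∘ σ-perm τ-perm) ⟩
        totalDeg (y ∘ σ ∘ τ)     ≡˘⟨ cong sumℕ (List.map-cong p≗yστ (allFin n)) ⟩
        totalDeg (p M)           ≡⟨ totalDeg-p ⟩
        entrySum sh M            ∎))
        where open ≡-Reasoning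

  columnEntry : Mono n → ℕ → Fin n → ℕ
  columnEntry y j i with colOf i ℕ.≟ j
  ... | yes _ = y i
  ... | no  _ = 0

  columnDegree : Mono n → ℕ → ℕ
  columnDegree y j = sumℕ (map (columnEntry y j) (allFin n))

  λ₁ : ℕ
  λ₁ = List.foldr (λ a _ → a) 0 sh

  mutual
    degT≡columnDegrees : ∀ y → degT y ≡ map (columnDegree y) (upTo λ₁)
    degT≡columnDegrees y = List.map-cong (λ j → cong sumℕ (List.map-cong (degT-entry y j) (allFin n))) (upTo λ₁)

    -- The left-hand side is the entry computed by the anonymous helper inside degT, which cannot be named.
    degT-entry : ∀ y j i → _ ≡ columnEntry y j i
    degT-entry y j i with colOf i ℕ.≟ j
    ... | yes _ = refl
    ... | no  _ = refl

  columnEntry-in : ∀ y {j i} → colOf i ≡ j → columnEntry y j i ≡ y i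
  columnEntry-in y {j} {i} i∈j with colOf i ℕ.≟ j
  ... | yes _   = refl
  ... | no  i∉j = ⊥-elim (i∉j i∈j)

  columnEntry-out : ∀ y {j i} → colOf i ≢ j → columnEntry y j i ≡ 0
  columnEntry-out y {j} {i} i∉j with colOf i ℕ.≟ j
  ... | yes i∈j = ⊥-elim (i∉j i∈j)
  ... | no  _   = refl

  degT-∘C : ∀ y {σ} → InC σ → degT (y ∘ σ) ≡ degT y
  degT-∘C y {σ} (σ-perm , σ-col) = begin
    degT (y ∘ σ)                           ≡⟨ degT≡columnDegrees (y ∘ σ) ⟩
    map (columnDegree (y ∘ σ)) (upTo λ₁)   ≡⟨ List.map-cong columnDegree-∘ (upTo λ₁) ⟩
    map (columnDegree y) (upTo λ₁)         ≡˘⟨ degT≡columnDegrees y ⟩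
    degT y                                 ∎
    where
    open ≡-Reasoning
    columnEntry-∘ : ∀ j i → columnEntry (y ∘ σ) j i ≡ columnEntry y j (σ i)
    columnEntry-∘ j i with colOf i ℕ.≟ j
    ... | yes i∈j = sym (columnEntry-in y (trans (σ-col i) i∈j))
    ... | no  i∉j = sym (columnEntry-out y (i∉j ∘ trans (sym (σ-col i))))
    columnDegree-∘ : ∀ j → columnDegree (y ∘ σ) j ≡ columnDegree y j
    columnDegree-∘ j = ℤ.+-injective (begin
      + columnDegree (y ∘ σ) j                  ≡⟨ +sumℕ-map (columnEntry (y ∘ σ) j) (allFin n) ⟩
      count (+_ ∘ columnEntry (y ∘ σ) j) (allFin n) ≡⟨ count-cong (cong +_ ∘ columnEntry-∘ j) (allFin n) ⟩
      count (+_ ∘ columnEntry y j ∘ σ) (allFin n)   ≡⟨ count-allFin-perm σ-perm (+_ ∘ columnEntry y j) ⟩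
      count (+_ ∘ columnEntry y j) (allFin n)       ≡˘⟨ +sumℕ-map (columnEntry y j) (allFin n) ⟩
      + columnDegree y j                        ∎)

  atLeastInRow : Mono n → ℕ → ℕ → Fin n → ℤ
  atLeastInRow w r v k = indℤ ((rowOf k ℕ.≟ r) ×-dec (v ℕ.≤? w k))

  entriesAtLeast : Mono n → ℕ → ℕ → ℤ
  entriesAtLeast w r v = count (atLeastInRow w r v) (allFin n)

  entriesAtLeast-∘R : ∀ w {τ} → InR τ → ∀ r v → entriesAtLeast (w ∘ τ) r v ≡ entriesAtLeast w r v
  entriesAtLeast-∘R w {τ} (τ-perm , τ-row) r v = trans
    (count-cong (λ k → indℤ-cong ((rowOf k ℕ.≟ r) ×-dec (v ℕ.≤? w (τ k))) ((rowOf (τ k) ℕ.≟ r) ×-dec (v ℕ.≤? w (τ k)))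
                                 (map₁ (trans (τ-row k))) (map₁ (trans (sym (τ-row k))))) (allFin n))
    (count-allFin-perm τ-perm (atLeastInRow w r v))

  module _ (M-ssyt : IsSSYT sh M) (sh↓ : Linked ℕ._≥_ sh) where

    open Inverse T using (from)

    p-row-mono : ∀ a b → rowOf a ≡ rowOf b → colOf a ℕ.≤ colOf b → p M a ℕ.≤ p M b
    p-row-mono a b = box-row-mono (from a) (from b)
      where
      box-row-mono : ∀ (x y : Box sh) → rowOfBox {sh} x ≡ rowOfBox {sh} y → colOfBox {sh} x ℕ.≤ colOfBox {sh} y → M x ℕ.≤ M y
      box-row-mono (r , c) (r′ , c′) r≡r′ c≤c′ with Fin.toℕ-injective r≡r′
      ... | refl = proj₁ M-ssyt r c c′ c≤c′

    colOf<λ₁ : ∀ i → colOf i ℕ.< λ₁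
    colOf<λ₁ i with from i
    ... | r , c = ℕ.<-≤-trans (Fin.toℕ<n c) (lookup≤head sh sh↓ r)

    -- Counting the entries ≥ q i in the row of i, which a row permutation does not change.
    column-dominated : ∀ {q τ} → InR τ → p M ≗ q ∘ τ → ∀ j → (∀ k → j ℕ.< colOf k → p M k ≡ q k) →
                       ∀ i → colOf i ≡ j → q i ℕ.≤ p M i
    column-dominated {q} {τ} τ∈R p≗qτ j agree i i∈j with q i ℕ.≤? p M i
    ... | yes q≤p = q≤p
    ... | no  q≰p = ⊥-elim (ℤ.<-irrefl same-count (count-allFin-< pointwise-≤ i at-i))
      where
      r v : ℕ
      r = rowOf i
      v = q i
      pi<v : p M i ℕ.< v
      pi<v = ℕ.≰⇒> q≰p
      same-count : entriesAtLeast (p M) r v ≡ entriesAtLeast q r v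
      same-count = trans (count-cong atLeast-∘ (allFin n)) (entriesAtLeast-∘R q τ∈R r v)
        where
        atLeast-∘ : ∀ k → atLeastInRow (p M) r v k ≡ atLeastInRow (q ∘ τ) r v k
        atLeast-∘ k = indℤ-cong ((rowOf k ℕ.≟ r) ×-dec (v ℕ.≤? p M k)) ((rowOf k ℕ.≟ r) ×-dec (v ℕ.≤? q (τ k)))
                                (map₂ (λ v≤ → subst (v ℕ.≤_) (p≗qτ k) v≤)) (map₂ (λ v≤ → subst (v ℕ.≤_) (sym (p≗qτ k)) v≤))
      right-of-j : ∀ k → rowOf k ≡ r → v ℕ.≤ p M k → j ℕ.< colOf k
      right-of-j k k∈r v≤pk with colOf k ℕ.≤? j
      ... | yes k≤j = ⊥-elim (ℕ.<⇒≱ pi<v (ℕ.≤-trans v≤pk (p-row-mono k i k∈r (subst (colOf k ℕ.≤_) (sym i∈j) k≤j))))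
      ... | no  k≰j = ℕ.≰⇒> k≰j
      pointwise-≤ : ∀ k → atLeastInRow (p M) r v k ≤ atLeastInRow q r v k
      pointwise-≤ k = indℤ-mono-≤ ((rowOf k ℕ.≟ r) ×-dec (v ℕ.≤? p M k)) ((rowOf k ℕ.≟ r) ×-dec (v ℕ.≤? q k))
                        (λ (k∈r , v≤pk) → k∈r , subst (v ℕ.≤_) (agree k (right-of-j k k∈r v≤pk)) v≤pk)
      at-i : atLeastInRow (p M) r v i < atLeastInRow q r v i
      at-i rewrite indℤ-no ((rowOf i ℕ.≟ r) ×-dec (v ℕ.≤? p M i)) (λ (_ , v≤pi) → ℕ.<⇒≱ pi<v v≤pi)
                 | indℤ-yes ((rowOf i ℕ.≟ r) ×-dec (v ℕ.≤? q i)) (refl , ℕ.≤-refl) = ℤ.+<+ (ℕ.s≤s ℕ.z≤n)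

    -- Take the rightmost column j in which p M and q differ: to its right the column degrees agree,
    -- and in column j every entry of q is at most that of p M, strictly so somewhere.
    row-orbit-below : ∀ {q τ} → InR τ → p M ≗ q ∘ τ → ¬ (p M ≗ q) → p M >T q
    row-orbit-below {q} {τ} τ∈R p≗qτ p≉q =
      subst₂ RevLexGT (sym (degT≡columnDegrees (p M))) (sym (degT≡columnDegrees q))
        (revLexGT-map-upTo λ₁ (columnDegree (p M)) (columnDegree q) j (colOf<λ₁ i*) column-j-smaller right-of-j-equal)
      where
      differs? : ∀ i → Dec (p M i ≢ q i)
      differs? i = ¬? (p M i ℕ.≟ q i)
      rightmost : ∃ λ i → p M i ≢ q i × (∀ k → p M k ≢ q k → colOf k ℕ.≤ colOf i)
      rightmost = let i₀ , differs = Fin.¬∀⟶∃¬ n _ (λ i → p M i ℕ.≟ q i) p≉q in argmax differs? colOf differs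
      i* : Fin n
      i* = proj₁ rightmost
      j : ℕ
      j = colOf i*
      agree : ∀ k → j ℕ.< colOf k → p M k ≡ q k
      agree k j<k with p M k ℕ.≟ q k
      ... | yes pk≡qk = pk≡qk
      ... | no  pk≢qk = ⊥-elim (ℕ.<⇒≱ j<k (proj₂ (proj₂ rightmost) k pk≢qk))
      q≤p-in-j : ∀ i → colOf i ≡ j → q i ℕ.≤ p M i
      q≤p-in-j = column-dominated τ∈R p≗qτ j agree
      entry-≤ : ∀ k → + columnEntry q j k ≤ + columnEntry (p M) j k
      entry-≤ k with colOf k ℕ.≟ j
      ... | yes k∈j = ℤ.+≤+ (q≤p-in-j k k∈j)
      ... | no  _   = ℤ.≤-refl
      entry-< : + columnEntry q j i* < + columnEntry (p M) j i*
      entry-< rewrite columnEntry-in q {j} {i*} refl | columnEntry-in (p M) {j} {i*} refl =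
        ℤ.+<+ (ℕ.≤∧≢⇒< (q≤p-in-j i* refl) (proj₁ (proj₂ rightmost) ∘ sym))
      column-j-smaller : columnDegree q j ℕ.< columnDegree (p M) j
      column-j-smaller = ℤ.drop‿+<+ (subst₂ _<_ (sym (+sumℕ-map (columnEntry q j) (allFin n))) (sym (+sumℕ-map (columnEntry (p M) j) (allFin n)))
                                                (count-allFin-< entry-≤ i* entry-<))
      right-of-j-equal : ∀ k → j ℕ.< k → k ℕ.< λ₁ → columnDegree (p M) k ≡ columnDegree q k
      right-of-j-equal k j<k _ = cong sumℕ (List.map-cong entry-≡ (allFin n))
        where
        entry-≡ : ∀ i → columnEntry (p M) k i ≡ columnEntry q k i
        entry-≡ i with colOf i ℕ.≟ k
        ... | yes i∈k = agree i (subst (j ℕ.<_) (sym i∈k) j<k)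
        ... | no  _   = refl

    rowCount-on-C : ∀ y {σ} → ¬ (p M >T y) → InC σ → rowCount (y ∘ σ) ≡ rowCount (p M) * indℤ (p M ≐? (y ∘ σ))
    rowCount-on-C y {σ} p≯y σ∈C with p M ≐? (y ∘ σ)
    ... | yes p≗yσ = trans (rowCount-orbit (y ∘ σ) (id , (isPerm-id , λ _ → refl) , p≗yσ)) (sym (ℤ.*-identityʳ _))
    ... | no  p≉yσ with rowCount-off-orbit (y ∘ σ)
    ...   | inj₁ none               = trans none (sym (ℤ.*-zeroʳ (rowCount (p M))))
    ...   | inj₂ (τ , τ∈R , p≗yστ) =
      ⊥-elim (p≯y (subst (RevLexGT (degT (p M))) (degT-∘C y σ∈C) (row-orbit-below τ∈R p≗yστ p≉yσ)))

    εp-leading : ∀ y → ¬ (p M >T y) → εp M y ≡ rowCount (p M) * leading M y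
    εp-leading y p≯y = begin
      εp M y                                                 ≡⟨ εp-over-allFuns y ⟩
      count (columnTerm y) (allFuns n)                       ≡⟨ count-cong factor (allFuns n) ⟩
      count (λ σ → rowCount (p M) * leadingTerm σ) (allFuns n) ≡⟨ count-*ˡ (rowCount (p M)) leadingTerm (allFuns n) ⟩
      rowCount (p M) * count leadingTerm (allFuns n)         ≡˘⟨ cong (rowCount (p M) *_) (count-filter-allPerms inC? (λ _ → proj₁) _) ⟩
      rowCount (p M) * leading M y                           ∎
      where
      open ≡-Reasoning
      leadingTerm : (Fin n → Fin n) → ℤ
      leadingTerm σ = χC σ * (sgn σ * indℤ (p M ≐? (y ∘ σ)))
      factor : ∀ σ → columnTerm y σ ≡ rowCount (p M) * leadingTerm σ
      factor σ = trans (indℤ-*-cong (inC? σ) (cong (sgn σ *_) ∘ rowCount-on-C y p≯y))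
                       (solve 4 (λ c s w i → c :* (s :* (w :* i)) := w :* (c :* (s :* i))) refl
                              (χC σ) (sgn σ) (rowCount (p M)) (indℤ (p M ≐? (y ∘ σ))))

proposition2p5 : (n : ℕ) (sh : List ℕ) → IsPartition n sh →
    (T : Box sh ↔ Fin n) → (M : Box sh → ℕ) → IsSSYT sh M →
    let open Tableau sh T in
    -- F_{M,T} ∈ ℤ[x_1..x_n]_d with d = Σ(M)
    ((∀ (y : Mono n) → ∃ λ (z : ℤ) → F M y ≡ z / 1)
      × (∀ (y : Mono n) → totalDeg y ≢ entrySum sh M → F M y ≡ 0ℚ))
    -- F_{M,T} − Σ_{σ∈C(T)} sgn(σ) σ p_{M,T} is supported on monomials y with p_{M,T} >_T y
    × (∀ (y : Mono n) → ¬ (p M >T y) → F M y ≡ leading M y / 1)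
    -- σ ∈ C̃(T) acts on F_{M,T} as multiplication by s̃gn(σ)
    × (∀ (g : Fin n → Fin n) (d : InCt g) (y : Mono n) →
         F M (y ∘ g) ≡ (sgnTilde d / 1) ℚ.* F M y)
proposition2p5 n sh (sh↓ , _) T M M-ssyt = (integral , homogeneous) , leading-term , equivariant
  where
  open Tableau sh T
  k : ℕ
  k = proj₁ (rowCount-positive sh T M)
  F≡εp/s : ∀ y → F M y ≡ εp M y / suc k
  F≡εp/s = F≡εp/[1+k] sh T M (proj₂ (rowCount-positive sh T M))
  F≡z/1 : ∀ y z → εp M y ≡ rowCount sh T M (p M) * z → F M y ≡ z / 1
  F≡z/1 y z εp≡sz = trans (F≡εp/s y) (trans (cong (_/ suc k) (trans εp≡sz (cong (_* z) (proj₂ (rowCount-positive sh T M)))))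
                                          ([n*z]/n≡z/1 k z))

  integral : ∀ y → ∃ λ z → F M y ≡ z / 1
  integral y = let z , εp≡sz = εp-multiple-of-rowCount sh T M y in z , F≡z/1 y z εp≡sz

  homogeneous : ∀ y → totalDeg y ≢ entrySum sh M → F M y ≡ 0ℚ
  homogeneous y deg≢ = trans (F≡εp/s y) (trans (cong (_/ suc k) (εp-homogeneous sh T M y deg≢)) (ℚ.0/n≡0 (suc k)))

  leading-term : ∀ y → ¬ (p M >T y) → F M y ≡ leading M y / 1
  leading-term y p≯y = F≡z/1 y (leading M y) (εp-leading sh T M M-ssyt sh↓ y p≯y)

  equivariant : ∀ g (d : InCt g) y → F M (y ∘ g) ≡ (sgnTilde d / 1) ℚ.* F M y
  equivariant g d y = begin
    F M (y ∘ g)                          ≡⟨ F≡εp/s (y ∘ g) ⟩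
    εp M (y ∘ g) / suc k                 ≡⟨ cong (_/ suc k) (εp-equivariant sh T M d y) ⟩
    (sgnTilde d * εp M y) / suc k        ≡⟨ [c*z]/n≡c/1*z/n k (sgnTilde d) (εp M y) ⟩
    (sgnTilde d / 1) ℚ.* (εp M y / suc k) ≡˘⟨ cong ((sgnTilde d / 1) ℚ.*_) (F≡εp/s y) ⟩
    (sgnTilde d / 1) ℚ.* F M y           ∎
    where open ≡-Reasoning
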